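{- Let $N, L\ge1$ be integers and let $\sigma_0,\dots,\sigma_{L-1}$ be permutations of $\{1,\dots,N\}$. Then there exists a permutation $\pi$ of $\{1,\dots,N\}$ such that for all $1\le j\le N$, $$\#\{0\le \ell<L:\ \sigma_\ell(j)=\pi(j)\}\ \ge\ 2L\alpha(N),$$ where $\alpha(N)=\frac{2}{N(N+2)}$ if $N$ is even and $\alpha(N)=\frac{2}{(N+1)^2}$ if $N$ is odd. -}

module Defs where

open import Data.Nat using (ℕ; zero; suc; _+_; _*_)
open import Data.Nat.Divisibility using (_∣?_)
open import Data.Fin using (Fin; _≟_)
open import Data.List using (length; filter)
open import Data.Fin.Permutation using (Permutation′; _⟨$⟩ʳ_)
open import Data.Integer using (+_)
open import Data.Rational using (ℚ; _/_)
open import Relation.Nullary using (yes; no)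
open import Data.List using (List)
import Data.List as List
import Data.List.Base as F

-- The N = 0 case is never used (the statement assumes N ≥ 1); we give
-- the N = 0 value 2/(1*2) only to make the function total / denominators nonzero.
α : ℕ → ℚ
α zero = + 2 / 2
α (suc n) with 2 ∣? suc n
... | yes _ = + 2 / (suc n * suc (suc (suc n)))
... | no  _ = + 2 / (suc (suc n) * suc (suc n))

agreeCount : {N L : ℕ} → (Fin L → Permutation′ N) → Permutation′ N → Fin N → ℕ
agreeCount {L = L} σ π j =
  length (filter (λ ℓ → (σ ℓ ⟨$⟩ʳ j) ≟ (π ⟨$⟩ʳ j)) (F.allFin L))

module Submission where

-- Let A be the N × N agreement matrix of σ₀, …, σ_{L-1}: the entry A(j, k)
-- counts the ℓ with σ_ℓ(j) = k, so every row and every column of A sums to L.  Write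
-- α(N) = 2 / D and call an entry heavy when D · A(j, k) ≥ 4L, i.e. A(j, k) ≥ 2Lα(N).
-- The heavy entries satisfy Hall's condition: if a set S of rows had all its heavy
-- entries in a set T of fewer columns, the mass ≥ (|S| − |T|)L of the rows of S lying
-- outside T would sit on |S|(N − |T|) light entries, forcing D(|S| − |T|) < 4|S|(N − |T|);
-- this contradicts D ≥ 4s(N + 1 − s) for 1 ≤ s ≤ N, an instance of AM–GM (sharpened by
-- parity when N is even).  Hall's theorem then gives an injective choice j ↦ π(j) of a
-- heavy entry in each row; an injection of Fin N into itself is a permutation, and the
-- heaviness of A(j, π(j)) = #{ℓ : σ_ℓ(j) = π(j)} is exactly the claimed bound.

module FiniteSubsets where

  open import Data.Nat using (ℕ; suc; _+_; _≤_; _<_; z≤n)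
  open import Data.Nat.Properties using (+-suc; +-identityʳ; m≤m+n; ≤-<-trans; <-irrefl)
  open import Data.Bool using (true; false)
  open import Data.Fin using (Fin)
  open import Data.Fin.Subset using (Subset; _∈_; _∉_; _∪_; _∩_; _─_; ∣_∣; Empty; Nonempty)
  open import Data.Fin.Subset.Properties
    using (Empty-unique; ∣⊥∣≡0; x∈p∩q⁻; x∈p⇒∣p-x∣<∣p∣; nonempty?)
  open import Data.Vec using ([]; _∷_; here; there; tabulate)
  open import Data.Vec.Properties using (lookup∘tabulate; []=⇒lookup; lookup⇒[]=)
  open import Data.Product using (_×_; _,_)
  open import Relation.Nullary using (Dec; yes; no; does; contradiction)
  open import Relation.Nullary.Decidable using (dec-true)
  open import Relation.Binary.PropositionalEquality
  open import Function using (_∘_)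

  private variable n : ℕ

  ∣p∪q∣+∣p∩q∣≡∣p∣+∣q∣ : (p q : Subset n) → ∣ p ∪ q ∣ + ∣ p ∩ q ∣ ≡ ∣ p ∣ + ∣ q ∣
  ∣p∪q∣+∣p∩q∣≡∣p∣+∣q∣ []          []          = refl
  ∣p∪q∣+∣p∩q∣≡∣p∣+∣q∣ (true ∷ p)  (true ∷ q)  =
    cong suc (trans (+-suc _ _) (trans (cong suc (∣p∪q∣+∣p∩q∣≡∣p∣+∣q∣ p q)) (sym (+-suc _ _))))
  ∣p∪q∣+∣p∩q∣≡∣p∣+∣q∣ (true ∷ p)  (false ∷ q) = cong suc (∣p∪q∣+∣p∩q∣≡∣p∣+∣q∣ p q)
  ∣p∪q∣+∣p∩q∣≡∣p∣+∣q∣ (false ∷ p) (true ∷ q)  =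
    trans (cong suc (∣p∪q∣+∣p∩q∣≡∣p∣+∣q∣ p q)) (sym (+-suc _ _))
  ∣p∪q∣+∣p∩q∣≡∣p∣+∣q∣ (false ∷ p) (false ∷ q) = ∣p∪q∣+∣p∩q∣≡∣p∣+∣q∣ p q

  ∣p∪q∣≤∣p∣+∣q∣ : (p q : Subset n) → ∣ p ∪ q ∣ ≤ ∣ p ∣ + ∣ q ∣
  ∣p∪q∣≤∣p∣+∣q∣ p q = subst (∣ p ∪ q ∣ ≤_) (∣p∪q∣+∣p∩q∣≡∣p∣+∣q∣ p q) (m≤m+n _ _)

  Empty⇒∣p∣≡0 : {p : Subset n} → Empty p → ∣ p ∣ ≡ 0
  Empty⇒∣p∣≡0 {n} empty = trans (cong ∣_∣ (Empty-unique empty)) (∣⊥∣≡0 n)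

  disjoint⇒∣p∪q∣≡∣p∣+∣q∣ : (p q : Subset n) → (∀ {x} → x ∈ p → x ∉ q) → ∣ p ∪ q ∣ ≡ ∣ p ∣ + ∣ q ∣
  disjoint⇒∣p∪q∣≡∣p∣+∣q∣ p q disjoint = begin
    ∣ p ∪ q ∣                ≡⟨ +-identityʳ _ ⟨
    ∣ p ∪ q ∣ + 0            ≡⟨ cong (∣ p ∪ q ∣ +_) (Empty⇒∣p∣≡0 p∩q-empty) ⟨
    ∣ p ∪ q ∣ + ∣ p ∩ q ∣    ≡⟨ ∣p∪q∣+∣p∩q∣≡∣p∣+∣q∣ p q ⟩
    ∣ p ∣ + ∣ q ∣            ∎
    where
    open ≡-Reasoning
    p∩q-empty : Empty (p ∩ q)
    p∩q-empty (x , x∈p∩q) with x∈p∩q⁻ p q x∈p∩q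
    ... | x∈p , x∈q = disjoint x∈p x∈q

  Nonempty⇒∣p∣>0 : {p : Subset n} → Nonempty p → 0 < ∣ p ∣
  Nonempty⇒∣p∣>0 (x , x∈p) = ≤-<-trans z≤n (x∈p⇒∣p-x∣<∣p∣ x∈p)

  ∣p∣>0⇒Nonempty : (p : Subset n) → 0 < ∣ p ∣ → Nonempty p
  ∣p∣>0⇒Nonempty p positive with nonempty? p
  ... | yes nonempty = nonempty
  ... | no  empty    = contradiction positive (<-irrefl (sym (Empty⇒∣p∣≡0 empty)))

  x∈p─q⁻ : (p q : Subset n) {x : Fin n} → x ∈ p ─ q → x ∈ p × x ∉ q
  x∈p─q⁻ (_ ∷ p)    (_ ∷ q)     (there x∈p─q) with x∈p─q⁻ p q x∈p─q
  ... | x∈p , x∉q = there x∈p , λ { (there x∈q) → x∉q x∈q }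
  x∈p─q⁻ (true ∷ p) (false ∷ q) here          = here , λ ()

  select : {P : Fin n → Set} → ((i : Fin n) → Dec (P i)) → Subset n
  select P? = tabulate (does ∘ P?)

  select⁺ : {P : Fin n → Set} (P? : (i : Fin n) → Dec (P i)) {i : Fin n} → P i → i ∈ select P?
  select⁺ P? {i} p =
    lookup⇒[]= i (select P?) (trans (lookup∘tabulate (does ∘ P?) i) (dec-true (P? i) p))

  select⁻ : {P : Fin n → Set} (P? : (i : Fin n) → Dec (P i)) {i : Fin n} → i ∈ select P? → P i
  select⁻ P? {i} i∈ with P? i | trans (sym (lookup∘tabulate (does ∘ P?) i)) ([]=⇒lookup i∈)
  ... | yes p | _ = p


module HallTheorem where

  open import Data.Nat using (ℕ; zero; suc; _+_; _≤_; _<_; z≤n; _≤?_; _<?_)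
  open import Data.Nat.Properties
    using (+-cancelʳ-≤; +-monoʳ-≤; ≤-refl; ≤-trans; ≤-pred; ≤-<-trans; ≰⇒>; module ≤-Reasoning)
  open import Data.Bool using (true; false)
  open import Data.Fin using (Fin; zero; suc; _≟_)
  open import Data.Fin.Subset
    using (Subset; _∈_; _∉_; _⊆_; _∪_; _─_; _-_; ⁅_⁆; ⊥; ∣_∣; Empty; Nonempty)
  open import Data.Fin.Subset.Properties
    using ( _∈?_; _⊆?_; nonempty?; anySubset?; ∉⊥; x∈p∪q⁺; x∈p∪q⁻; x∈p∩q⁺; x∈p∧x∉q⇒x∈p─q
          ; x∈p∧x≢y⇒x∈p-y; p─q⊆p; p⊆q⇒∣p∣≤∣q∣; p∩q≢∅⇒∣p─q∣<∣p∣; x∈p⇒∣p-x∣<∣p∣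
          ; x∈⁅x⁆; x∈⁅y⁆⇒x≡y; ∣⁅x⁆∣≡1)
  open import Data.Vec using ([]; _∷_; here; there)
  open import Data.Product using (∃; _×_; _,_; proj₂)
  open import Data.Sum using (inj₁; inj₂)
  open import Data.Empty using (⊥-elim)
  open import Relation.Nullary using (Dec; yes; no; contradiction)
  open import Relation.Nullary.Decidable using (_×-dec_)
  open import Relation.Binary.PropositionalEquality
  open import Function using (_∘_; id)

  open FiniteSubsets

  private variable n m : ℕ

  Nb : (Fin n → Subset m) → Subset n → Subset m
  Nb R []          = ⊥
  Nb R (true ∷ S)  = R zero ∪ Nb (R ∘ suc) S
  Nb R (false ∷ S) = Nb (R ∘ suc) S

  Nb⁺ : (R : Fin n → Subset m) (S : Subset n) {i : Fin n} {k : Fin m} → i ∈ S → k ∈ R i → k ∈ Nb R S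
  Nb⁺ R (true ∷ S)  here        k∈Ri = x∈p∪q⁺ (inj₁ k∈Ri)
  Nb⁺ R (true ∷ S)  (there i∈S) k∈Ri = x∈p∪q⁺ (inj₂ (Nb⁺ (R ∘ suc) S i∈S k∈Ri))
  Nb⁺ R (false ∷ S) (there i∈S) k∈Ri = Nb⁺ (R ∘ suc) S i∈S k∈Ri

  Nb⁻ : (R : Fin n → Subset m) (S : Subset n) {k : Fin m} → k ∈ Nb R S → ∃ λ i → i ∈ S × k ∈ R i
  Nb⁻ R []          k∈Nb = contradiction k∈Nb ∉⊥
  Nb⁻ R (true ∷ S)  k∈Nb with x∈p∪q⁻ (R zero) (Nb (R ∘ suc) S) k∈Nb
  ... | inj₁ k∈R0 = zero , here , k∈R0
  ... | inj₂ k∈Nb′ with Nb⁻ (R ∘ suc) S k∈Nb′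
  ...   | i , i∈S , k∈Ri = suc i , there i∈S , k∈Ri
  Nb⁻ R (false ∷ S) k∈Nb with Nb⁻ (R ∘ suc) S k∈Nb
  ... | i , i∈S , k∈Ri = suc i , there i∈S , k∈Ri

  record Matching (A : Subset n) (R : Fin n → Subset m) : Set where
    field
      match      : Fin n → Fin m
      admissible : ∀ {i} → i ∈ A → match i ∈ R i
      injective  : ∀ {i j} → i ∈ A → j ∈ A → match i ≡ match j → i ≡ j

  HallCondition : Subset n → (Fin n → Subset m) → Set
  HallCondition A R = ∀ S → S ⊆ A → ∣ S ∣ ≤ ∣ Nb R S ∣

  glue : {A S : Subset n} {R R₁ R₂ : Fin n → Subset m} →
         (∀ {j} → j ∈ S → R₁ j ⊆ R j) → (∀ {j} → R₂ j ⊆ R j) →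
         (∀ {j j′ c} → j ∈ S → c ∈ R₁ j → c ∉ R₂ j′) →
         Matching S R₁ → Matching (A ─ S) R₂ → Matching A R
  glue {A = A} {S} {R} {R₁} {R₂} R₁⊆R R₂⊆R apart M₁ M₂ =
    record { match = f ; admissible = admissible ; injective = injective }
    where
    module M₁ = Matching M₁
    module M₂ = Matching M₂

    in-rest : ∀ {j} → j ∈ A → j ∉ S → j ∈ A ─ S
    in-rest = x∈p∧x∉q⇒x∈p─q

    f : Fin _ → Fin _
    f j with j ∈? S
    ... | yes _ = M₁.match j
    ... | no  _ = M₂.match j

    admissible : ∀ {j} → j ∈ A → f j ∈ R j
    admissible {j} j∈A with j ∈? S
    ... | yes j∈S = R₁⊆R j∈S (M₁.admissible j∈S)
    ... | no  j∉S = R₂⊆R (M₂.admissible (in-rest j∈A j∉S))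

    separated : ∀ {j j′} → j ∈ S → j′ ∈ A → j′ ∉ S → M₁.match j ≢ M₂.match j′
    separated j∈S j′∈A j′∉S eq =
      apart j∈S (M₁.admissible j∈S) (subst (_∈ R₂ _) (sym eq) (M₂.admissible (in-rest j′∈A j′∉S)))

    injective : ∀ {j j′} → j ∈ A → j′ ∈ A → f j ≡ f j′ → j ≡ j′
    injective {j} {j′} j∈A j′∈A eq with j ∈? S | j′ ∈? S
    ... | yes j∈S | yes j′∈S = M₁.injective j∈S j′∈S eq
    ... | yes j∈S | no  j′∉S = ⊥-elim (separated j∈S j′∈A j′∉S eq)
    ... | no  j∉S | yes j′∈S = ⊥-elim (separated j′∈S j∈A j∉S (sym eq))
    ... | no  j∉S | no  j′∉S = M₂.injective (in-rest j∈A j∉S) (in-rest j′∈A j′∉S) eq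

  empty-matching : {A : Subset n} {R : Fin n → Subset m} → Fin m → Empty A → Matching A R
  empty-matching d empty = record
    { match      = λ _ → d
    ; admissible = λ i∈A → ⊥-elim (empty (_ , i∈A))
    ; injective  = λ i∈A _ _ → ⊥-elim (empty (_ , i∈A))
    }

  edge-matching : (i : Fin n) (c : Fin m) → Matching ⁅ i ⁆ (λ _ → ⁅ c ⁆)
  edge-matching i c = record
    { match      = λ _ → c
    ; admissible = λ _ → x∈⁅x⁆ c
    ; injective  = λ j∈⁅i⁆ j′∈⁅i⁆ _ → trans (x∈⁅y⁆⇒x≡y i j∈⁅i⁆) (sym (x∈⁅y⁆⇒x≡y i j′∈⁅i⁆))
    }

  Critical : Subset n → (Fin n → Subset m) → Subset n → Set
  Critical A R S = S ⊆ A × Nonempty S × ∣ S ∣ < ∣ A ∣ × ∣ Nb R S ∣ ≤ ∣ S ∣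

  critical? : (A : Subset n) (R : Fin n → Subset m) (S : Subset n) → Dec (Critical A R S)
  critical? A R S = S ⊆? A ×-dec nonempty? S ×-dec ∣ S ∣ <? ∣ A ∣ ×-dec ∣ Nb R S ∣ ≤? ∣ S ∣

  hall-beyond-critical : {A S : Subset n} {R : Fin n → Subset m} → HallCondition A R →
    S ⊆ A → ∣ Nb R S ∣ ≤ ∣ S ∣ → HallCondition (A ─ S) (λ j → R j ─ Nb R S)
  hall-beyond-critical {A = A} {S} {R} condition S⊆A tight T T⊆A─S =
    +-cancelʳ-≤ (∣ S ∣) (∣ T ∣) (∣ Nb R′ T ∣) (begin
      ∣ T ∣ + ∣ S ∣         ≡⟨ disjoint⇒∣p∪q∣≡∣p∣+∣q∣ T S T∩S-empty ⟨
      ∣ T ∪ S ∣             ≤⟨ condition (T ∪ S) T∪S⊆A ⟩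
      ∣ Nb R (T ∪ S) ∣      ≤⟨ p⊆q⇒∣p∣≤∣q∣ cover ⟩
      ∣ Nb R′ T ∪ X ∣       ≤⟨ ∣p∪q∣≤∣p∣+∣q∣ (Nb R′ T) X ⟩
      ∣ Nb R′ T ∣ + ∣ X ∣   ≤⟨ +-monoʳ-≤ (∣ Nb R′ T ∣) tight ⟩
      ∣ Nb R′ T ∣ + ∣ S ∣   ∎)
    where
    open ≤-Reasoning
    X = Nb R S
    R′ : Fin _ → Subset _
    R′ j = R j ─ X

    T∩S-empty : ∀ {x} → x ∈ T → x ∉ S
    T∩S-empty x∈T with x∈p─q⁻ A S (T⊆A─S x∈T)
    ... | _ , x∉S = x∉S

    T∪S⊆A : T ∪ S ⊆ A
    T∪S⊆A x∈T∪S with x∈p∪q⁻ T S x∈T∪S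
    ... | inj₁ x∈T = p─q⊆p A S (T⊆A─S x∈T)
    ... | inj₂ x∈S = S⊆A x∈S

    cover : Nb R (T ∪ S) ⊆ Nb R′ T ∪ X
    cover {k} k∈Nb with Nb⁻ R (T ∪ S) k∈Nb
    ... | j , j∈T∪S , k∈Rj with k ∈? X | x∈p∪q⁻ T S j∈T∪S
    ...   | yes k∈X | _        = x∈p∪q⁺ (inj₂ k∈X)
    ...   | no  k∉X | inj₁ j∈T = x∈p∪q⁺ (inj₁ (Nb⁺ R′ T j∈T (x∈p∧x∉q⇒x∈p─q k∈Rj k∉X)))
    ...   | no  k∉X | inj₂ j∈S = contradiction (Nb⁺ R S j∈S k∈Rj) k∉X

  Surplus : Subset n → (Fin n → Subset m) → Set
  Surplus A R = ∀ S → S ⊆ A → Nonempty S → ∣ S ∣ < ∣ A ∣ → ∣ S ∣ < ∣ Nb R S ∣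

  hall-after-deleting : {A : Subset n} {R : Fin n → Subset m} {i : Fin n} (c : Fin m) →
    i ∈ A → Surplus A R → HallCondition (A - i) (λ j → R j - c)
  hall-after-deleting {A = A} {R} {i} c i∈A surplus T T⊆A-i with nonempty? T
  ... | no  empty    = subst (_≤ ∣ Nb R′ T ∣) (sym (Empty⇒∣p∣≡0 empty)) z≤n
    where
    R′ : Fin _ → Subset _
    R′ j = R j - c
  ... | yes nonempty = ≤-pred (begin-strict
      ∣ T ∣                     <⟨ surplus T T⊆A nonempty ∣T∣<∣A∣ ⟩
      ∣ Nb R T ∣                ≤⟨ p⊆q⇒∣p∣≤∣q∣ cover ⟩
      ∣ ⁅ c ⁆ ∪ Nb R′ T ∣        ≤⟨ ∣p∪q∣≤∣p∣+∣q∣ ⁅ c ⁆ (Nb R′ T) ⟩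
      ∣ ⁅ c ⁆ ∣ + ∣ Nb R′ T ∣    ≡⟨ cong (_+ ∣ Nb R′ T ∣) (∣⁅x⁆∣≡1 c) ⟩
      suc ∣ Nb R′ T ∣            ∎)
    where
    open ≤-Reasoning
    R′ : Fin _ → Subset _
    R′ j = R j - c

    T⊆A : T ⊆ A
    T⊆A x∈T = p─q⊆p A ⁅ i ⁆ (T⊆A-i x∈T)

    ∣T∣<∣A∣ : ∣ T ∣ < ∣ A ∣
    ∣T∣<∣A∣ = ≤-<-trans (p⊆q⇒∣p∣≤∣q∣ T⊆A-i) (x∈p⇒∣p-x∣<∣p∣ i∈A)

    cover : Nb R T ⊆ ⁅ c ⁆ ∪ Nb R′ T
    cover {k} k∈Nb with Nb⁻ R T k∈Nb
    ... | j , j∈T , k∈Rj with k ≟ c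
    ...   | yes refl = x∈p∪q⁺ (inj₁ (x∈⁅x⁆ c))
    ...   | no  k≢c  = x∈p∪q⁺ (inj₂ (Nb⁺ R′ T j∈T (x∈p∧x≢y⇒x∈p-y k∈Rj k≢c)))

  neighbour : {A : Subset n} {R : Fin n → Subset m} {i : Fin n} →
    HallCondition A R → i ∈ A → ∃ λ c → c ∈ R i
  neighbour {A = A} {R} {i} condition i∈A with ∣p∣>0⇒Nonempty (Nb R ⁅ i ⁆) at-least-one
    where
    at-least-one : 0 < ∣ Nb R ⁅ i ⁆ ∣
    at-least-one = subst (_≤ ∣ Nb R ⁅ i ⁆ ∣) (∣⁅x⁆∣≡1 i)
                     (condition ⁅ i ⁆ (λ j∈⁅i⁆ → subst (_∈ A) (sym (x∈⁅y⁆⇒x≡y i j∈⁅i⁆)) i∈A))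
  ... | c , c∈Nb with Nb⁻ R ⁅ i ⁆ c∈Nb
  ...   | j , j∈⁅i⁆ , c∈Rj = c , subst (λ j → c ∈ R j) (x∈⁅y⁆⇒x≡y i j∈⁅i⁆) c∈Rj

  -- Hall's marriage theorem (Halmos–Vaughan), by induction on ∣ A ∣: a critical set splits
  -- the problem into two smaller ones; otherwise there is surplus, and any edge i ↦ c can
  -- be fixed before matching the rest.
  hall : Fin m → (A : Subset n) (R : Fin n → Subset m) → HallCondition A R → Matching A R
  hall {m} {n} d A R = go ∣ A ∣ A R ≤-refl
    where
    shrink : ∀ {k a b} → b < a → a ≤ suc k → b ≤ k
    shrink smaller bound = ≤-pred (≤-trans smaller bound)

    go : ∀ k (A : Subset n) (R : Fin n → Subset m) → ∣ A ∣ ≤ k → HallCondition A R → Matching A R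
    go k A R bound condition with nonempty? A
    ... | no empty = empty-matching d empty
    go zero A R bound condition | yes nonempty =
      contradiction (≤-trans (Nonempty⇒∣p∣>0 nonempty) bound) λ ()
    go (suc k) A R bound condition | yes (i , i∈A) with anySubset? (critical? A R)
    ... | yes (S , S⊆A , (x , x∈S) , ∣S∣<∣A∣ , tight) =
      glue (λ _ → id)
           (λ {j} → p─q⊆p (R j) (Nb R S))
           (λ j∈S c∈Rj c∈R′ → proj₂ (x∈p─q⁻ _ _ c∈R′) (Nb⁺ R S j∈S c∈Rj))
           (go k S R (shrink ∣S∣<∣A∣ bound) (λ T T⊆S → condition T (S⊆A ∘ T⊆S)))
           (go k (A ─ S) (λ j → R j ─ Nb R S) (shrink ∣A─S∣<∣A∣ bound)
               (hall-beyond-critical condition S⊆A tight))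
      where
      ∣A─S∣<∣A∣ : ∣ A ─ S ∣ < ∣ A ∣
      ∣A─S∣<∣A∣ = p∩q≢∅⇒∣p─q∣<∣p∣ A S (x , x∈p∩q⁺ (S⊆A x∈S , x∈S))
    ... | no no-critical with neighbour condition i∈A
    ...   | c , c∈Ri =
      glue (λ j∈⁅i⁆ c′∈⁅c⁆ → subst₂ (λ c′ j → c′ ∈ R j)
                                (sym (x∈⁅y⁆⇒x≡y c c′∈⁅c⁆)) (sym (x∈⁅y⁆⇒x≡y i j∈⁅i⁆)) c∈Ri)
           (λ {j} → p─q⊆p (R j) ⁅ c ⁆)
           (λ _ c′∈⁅c⁆ c′∈R′ → proj₂ (x∈p─q⁻ _ _ c′∈R′) c′∈⁅c⁆)
           (edge-matching i c)
           (go k (A - i) (λ j → R j - c) (shrink (x∈p⇒∣p-x∣<∣p∣ i∈A) bound)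
               (hall-after-deleting c i∈A surplus))
      where
      surplus : Surplus A R
      surplus S S⊆A nonempty ∣S∣<∣A∣ =
        ≰⇒> (λ tight → no-critical (S , S⊆A , nonempty , ∣S∣<∣A∣ , tight))


module FinitePermutations where

  open import Data.Nat using (ℕ; suc)
  open import Data.Nat.Properties using (1+n≰n)
  open import Data.Fin using (Fin; _≟_; punchOut)
  open import Data.Fin.Properties using (any?; injective⇒≤; punchOut-injective)
  open import Data.Fin.Permutation using (Permutation′; permutation; _⟨$⟩ʳ_)
  open import Data.Product using (∃; _,_; proj₁; proj₂)
  open import Relation.Nullary using (yes; no; contradiction)
  open import Relation.Binary.PropositionalEquality
  open import Function using (_∘_)
  open import Function.Definitions using (Injective)

  private variable n : ℕ

  -- An injective self-map of Fin n hits every point: a missed point k would let f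
  -- squeeze Fin n injectively into Fin (n − 1).
  injective⇒surjective : (f : Fin n → Fin n) → Injective _≡_ _≡_ f → ∀ k → ∃ λ j → f j ≡ k
  injective⇒surjective {suc n} f injective k with any? (λ j → f j ≟ k)
  ... | yes hit  = hit
  ... | no  miss = contradiction (injective⇒≤ squeezed-injective) 1+n≰n
    where
    k≢f : ∀ j → k ≢ f j
    k≢f j k≡fj = miss (j , sym k≡fj)

    squeezed : Fin (suc n) → Fin n
    squeezed j = punchOut (k≢f j)

    squeezed-injective : Injective _≡_ _≡_ squeezed
    squeezed-injective {i} {j} eq = injective (punchOut-injective (k≢f i) (k≢f j) eq)

  injective⇒permutation : (f : Fin n → Fin n) → Injective _≡_ _≡_ f →
    ∃ λ (π : Permutation′ n) → ∀ j → π ⟨$⟩ʳ j ≡ f j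
  injective⇒permutation f injective =
    permutation f (proj₁ ∘ onto) (proj₂ ∘ onto) (λ j → injective (proj₂ (onto (f j)))) , λ _ → refl
    where
    onto = injective⇒surjective f injective


module FiniteSums where

  open import Data.Nat using (ℕ; zero; suc; _+_; _*_; _≤_; z≤n)
  open import Data.Nat.Properties using (+-*-semiring; +-mono-≤)
  open import Data.Bool using (true; false; if_then_else_)
  open import Data.Fin using (Fin; zero; suc; _≟_)
  open import Data.Fin.Subset using (Subset; ∣_∣)
  open import Data.Fin.Subset.Properties using (_∈?_)
  open import Data.Vec using ([]; _∷_)
  open import Data.List using (length; filter)
  import Data.List.Base as List
  open import Relation.Nullary using (Dec; yes; no; does; contradiction)
  open import Relation.Binary.PropositionalEquality
  open import Function using (_∘_)
  open import Algebra.Properties.Semiring.Sum +-*-semiring public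
    using (sum-syntax; ∑-distrib-+; ∑-comm; *-distribˡ-sum; *-distribʳ-sum; sum-cong-≗)

  private variable m n : ℕ

  indicator : {P : Set} → Dec P → ℕ
  indicator d = if does d then 1 else 0

  indicator-cong : {P Q : Set} (p : Dec P) (q : Dec Q) → (P → Q) → (Q → P) →
    indicator p ≡ indicator q
  indicator-cong (yes _) (yes _) _   _   = refl
  indicator-cong (no  _) (no  _) _   _   = refl
  indicator-cong (yes p) (no ¬q) p→q _   = contradiction (p→q p) ¬q
  indicator-cong (no ¬p) (yes q) _   q→p = contradiction (q→p q) ¬p

  ∑-mono-≤ : {f g : Fin n → ℕ} → (∀ i → f i ≤ g i) → ∑[ i < n ] f i ≤ ∑[ i < n ] g i
  ∑-mono-≤ {zero}  f≤g = z≤n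
  ∑-mono-≤ {suc n} f≤g = +-mono-≤ (f≤g zero) (∑-mono-≤ (f≤g ∘ suc))

  ∑-const-1 : ∑[ i < n ] 1 ≡ n
  ∑-const-1 {zero}  = refl
  ∑-const-1 {suc n} = cong suc (∑-const-1 {n})

  ∑-δ : (x : Fin n) → ∑[ k < n ] indicator (x ≟ k) ≡ 1
  ∑-δ {suc n} zero    = cong suc (∑-zero {n})
    where
    ∑-zero : ∀ {n} → ∑[ k < n ] indicator (zero {n} ≟ suc k) ≡ 0
    ∑-zero {zero}  = refl
    ∑-zero {suc n} = ∑-zero {n}
  ∑-δ {suc n} (suc x) = ∑-δ x

  ∣p∣≡∑𝟙 : (p : Subset n) → ∣ p ∣ ≡ ∑[ i < n ] indicator (i ∈? p)
  ∣p∣≡∑𝟙 []          = refl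
  ∣p∣≡∑𝟙 (true ∷ p)  = cong suc (∣p∣≡∑𝟙 p)
  ∣p∣≡∑𝟙 (false ∷ p) = ∣p∣≡∑𝟙 p

  length-filter-tabulate : ∀ {A : Set} {P : A → Set} (P? : ∀ a → Dec (P a)) (f : Fin n → A) →
    length (filter P? (List.tabulate f)) ≡ ∑[ i < n ] indicator (P? (f i))
  length-filter-tabulate {zero}  P? f = refl
  length-filter-tabulate {suc n} P? f with P? (f zero)
  ... | yes _ = cong suc (length-filter-tabulate P? (f ∘ suc))
  ... | no  _ = length-filter-tabulate P? (f ∘ suc)

  *-distribˡ-∑∑ : ∀ c (f : Fin m → Fin n → ℕ) →
    c * ∑[ j < m ] ∑[ k < n ] f j k ≡ ∑[ j < m ] ∑[ k < n ] (c * f j k)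
  *-distribˡ-∑∑ {m} {n} c f =
    trans (*-distribˡ-sum c (λ j → ∑[ k < n ] f j k)) (sum-cong-≗ (λ j → *-distribˡ-sum c (f j)))

  ∑∑-distrib-+ : (f g : Fin m → Fin n → ℕ) →
    ∑[ j < m ] ∑[ k < n ] (f j k + g j k)
      ≡ ∑[ j < m ] ∑[ k < n ] f j k + ∑[ j < m ] ∑[ k < n ] g j k
  ∑∑-distrib-+ {m} {n} f g = trans (sum-cong-≗ (λ j → ∑-distrib-+ (f j) (g j)))
                                   (∑-distrib-+ (λ j → ∑[ k < n ] f j k) (λ j → ∑[ k < n ] g j k))

  ∑∑-product : (f : Fin m → ℕ) (g : Fin n → ℕ) →
    ∑[ j < m ] ∑[ k < n ] (f j * g k) ≡ (∑[ j < m ] f j) * (∑[ k < n ] g k)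
  ∑∑-product {m} {n} f g = begin
    ∑[ j < m ] ∑[ k < n ] (f j * g k)   ≡⟨ sum-cong-≗ (λ j → *-distribˡ-sum (f j) g) ⟨
    ∑[ j < m ] (f j * ∑[ k < n ] g k)   ≡⟨ *-distribʳ-sum (∑[ k < n ] g k) f ⟨
    (∑[ j < m ] f j) * ∑[ k < n ] g k   ∎
    where open ≡-Reasoning


module DoubleCounting where

  open import Data.Nat using (ℕ; suc; _+_; _*_; _≤_; _<_; z≤n; _≤?_; _<?_)
  open import Data.Nat.Properties
    using ( +-comm; +-identityʳ; *-identityˡ; *-identityʳ; *-zeroʳ; +-mono-≤; *-monoʳ-≤; m≤m*n
          ; m≤m+n; ≤-refl; ≤-reflexive; ≤-trans; ≰⇒>; ≮⇒≥; +-cancelˡ-≤; +-cancelˡ-≡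
          ; m≤n⇒∃[o]m+o≡n; m+[n∸m]≡n; module ≤-Reasoning)
  open import Data.Nat.Tactic.RingSolver using (solve-∀)
  open import Data.Fin using (Fin)
  open import Data.Fin.Subset using (Subset; _∈_; _∉_; ∣_∣; ⊤; ∁)
  open import Data.Fin.Subset.Properties using (_∈?_; ∣p∣≤n; ∣∁p∣≡n∸∣p∣; x∈∁p⇒x∉p; x∉p⇒x∈∁p)
  open import Data.Product using (_,_)
  open import Data.Empty using (⊥; ⊥-elim)
  open import Relation.Nullary using (yes; no; contradiction)
  open import Relation.Binary.PropositionalEquality

  open FiniteSubsets using (select; select⁺)
  open HallTheorem using (Nb; Nb⁺; HallCondition)
  open FiniteSums

  private variable n : ℕ

  -- Capacity: D ≥ a·s·(n + 1 − s) for all s ≤ n  (writing s + e = n).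
  Capacity : (a n D : ℕ) → Set
  Capacity a n D = ∀ s e → s + e ≡ n → a * s * suc e ≤ D

  -- With s = r + (1 + d) and s + e = n, capacity bounds a·s·(n − r) by (s − r)·D.
  crowding : ∀ {a n D} → Capacity a n D → ∀ s d e → s + e ≡ n → a * s * (suc d + e) ≤ suc d * D
  crowding {a} {n} {D} capacity s d e s+e≡n = begin
    a * s * (suc d + e)           ≡⟨ split a s d e ⟩
    a * s * suc e + d * (a * s)   ≤⟨ +-mono-≤ (capacity s e s+e≡n) (*-monoʳ-≤ d a*s≤D) ⟩
    D + d * D                     ∎
    where
    open ≤-Reasoning
    split : ∀ a s d e → a * s * (suc d + e) ≡ a * s * suc e + d * (a * s)
    split = solve-∀
    a*s≤D : a * s ≤ D
    a*s≤D = ≤-trans (m≤m*n (a * s) (suc e)) (capacity s e s+e≡n)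

  -- Rows s > r columns, mass P ≥ (s − r)·L
  -- outside those columns, spread over s·w entries each lighter than a·L / D
  -- (so D·P + s·w ≤ a·L·s·w): impossible under the capacity bound.
  no-overcrowding : ∀ {a n D L r s w P} → Capacity a n D → r < s → s ≤ n → r + w ≡ n →
    s * L ≤ r * L + P → D * P + s * w ≤ a * L * (s * w) → ⊥
  no-overcrowding {a} {n} {D} {L} {r} {s} {w} {P} capacity r<s s≤n r+w≡n mass light
    with m≤n⇒∃[o]m+o≡n r<s | m≤n⇒∃[o]m+o≡n s≤n
  ... | d , refl | e , refl with +-cancelˡ-≡ r w (suc d + e) (trans r+w≡n (shift r d e))
    where
    shift : ∀ r d e → suc r + d + e ≡ r + (suc d + e)
    shift = solve-∀
  ...   | refl = contradiction (+-cancelˡ-≤ (D * P) (s * w) 0 (begin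
      D * P + s * w               ≤⟨ light ⟩
      a * L * (s * w)             ≡⟨ regroup₁ a L s w ⟩
      L * (a * s * w)             ≤⟨ *-monoʳ-≤ L (crowding {a} capacity s d e refl) ⟩
      L * (suc d * D)             ≡⟨ regroup₂ L d D ⟩
      D * (suc d * L)             ≤⟨ *-monoʳ-≤ D escaped ⟩
      D * P                       ≡⟨ +-identityʳ _ ⟨
      D * P + 0                   ∎)) λ ()
    where
    open ≤-Reasoning
    regroup₁ : ∀ a L s w → a * L * (s * w) ≡ L * (a * s * w)
    regroup₁ = solve-∀
    regroup₂ : ∀ L d D → L * (suc d * D) ≡ D * (suc d * L)
    regroup₂ = solve-∀
    split : ∀ r d L → (suc r + d) * L ≡ r * L + suc d * L
    split = solve-∀
    escaped : suc d * L ≤ P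
    escaped = +-cancelˡ-≤ (r * L) _ _ (subst (_≤ r * L + P) (split r d L) mass)

  record Balanced (L : ℕ) (M : Fin n → Fin n → ℕ) : Set where
    field
      row-sum : ∀ j → ∑[ k < n ] M j k ≡ L
      col-sum : ∀ k → ∑[ j < n ] M j k ≡ L

  transpose : ∀ {L} {M : Fin n → Fin n → ℕ} → Balanced L M → Balanced L (λ j k → M k j)
  transpose balanced = record { row-sum = col-sum ; col-sum = row-sum }
    where open Balanced balanced

  mass-of-rows : ∀ {L} {M : Fin n → Fin n → ℕ} → Balanced L M → (S : Subset n) →
    ∑[ j < n ] ∑[ k < n ] (indicator (j ∈? S) * M j k) ≡ ∣ S ∣ * L
  mass-of-rows {n} {L} {M} balanced S = begin
    ∑[ j < n ] ∑[ k < n ] (𝟙S j * M j k)   ≡⟨ sum-cong-≗ (λ j → *-distribˡ-sum (𝟙S j) (M j)) ⟨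
    ∑[ j < n ] (𝟙S j * ∑[ k < n ] M j k)   ≡⟨ sum-cong-≗ (λ j → cong (𝟙S j *_) (row-sum j)) ⟩
    ∑[ j < n ] (𝟙S j * L)                  ≡⟨ *-distribʳ-sum L 𝟙S ⟨
    (∑[ j < n ] 𝟙S j) * L                  ≡⟨ cong (_* L) (∣p∣≡∑𝟙 S) ⟨
    ∣ S ∣ * L                              ∎
    where
    open ≡-Reasoning
    open Balanced balanced
    𝟙S : Fin n → ℕ
    𝟙S j = indicator (j ∈? S)

  block : Subset n → Subset n → Fin n → Fin n → ℕ
  block S T j k = indicator (j ∈? S) * indicator (k ∈? ∁ T)

  escaping-mass : ∀ {L} {M : Fin n → Fin n → ℕ} → Balanced L M → (S T : Subset n) →
    ∣ S ∣ * L ≤ ∣ T ∣ * L + ∑[ j < n ] ∑[ k < n ] (block S T j k * M j k)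
  escaping-mass {n} {L} {M} balanced S T = begin
    ∣ S ∣ * L                                     ≡⟨ mass-of-rows balanced S ⟨
    ∑[ j < n ] ∑[ k < n ] (𝟙S j * M j k)           ≤⟨ ∑-mono-≤ (λ j → ∑-mono-≤ (split j)) ⟩
    ∑[ j < n ] ∑[ k < n ] (𝟙T k * M j k + B j k)   ≡⟨ ∑∑-distrib-+ (λ j k → 𝟙T k * M j k) B ⟩
    ∑[ j < n ] ∑[ k < n ] (𝟙T k * M j k) + P       ≡⟨ cong (_+ P) columns ⟩
    ∣ T ∣ * L + P                                 ∎
    where
    open ≤-Reasoning
    𝟙S 𝟙T : Fin n → ℕ
    𝟙S j = indicator (j ∈? S)
    𝟙T k = indicator (k ∈? T)
    B : Fin n → Fin n → ℕ
    B j k = block S T j k * M j k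
    P : ℕ
    P = ∑[ j < n ] ∑[ k < n ] B j k

    split : ∀ j k → 𝟙S j * M j k ≤ 𝟙T k * M j k + B j k
    split j k with j ∈? S | k ∈? T | k ∈? ∁ T
    ... | no  _ | _       | _        = z≤n
    ... | yes _ | yes _   | _        = m≤m+n _ _
    ... | yes _ | no  _   | yes _    = ≤-refl
    ... | yes _ | no  k∉T | no  k∉∁T = contradiction (x∉p⇒x∈∁p k∉T) k∉∁T

    columns : ∑[ j < n ] ∑[ k < n ] (𝟙T k * M j k) ≡ ∣ T ∣ * L
    columns = trans (∑-comm (λ j k → 𝟙T k * M j k)) (mass-of-rows (transpose balanced) T)

  light-block : ∀ {a D L} {M : Fin n → Fin n → ℕ} (S T : Subset n) →
    (∀ {j k} → j ∈ S → k ∉ T → D * M j k < a * L) →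
    D * ∑[ j < n ] ∑[ k < n ] (block S T j k * M j k) + ∑[ j < n ] ∑[ k < n ] block S T j k
      ≤ a * L * ∑[ j < n ] ∑[ k < n ] block S T j k
  light-block {n} {a} {D} {L} {M} S T light = begin
    D * ∑[ j < n ] ∑[ k < n ] (B j k * M j k) + Q
        ≡⟨ cong (_+ Q) (*-distribˡ-∑∑ D (λ j k → B j k * M j k)) ⟩
    ∑[ j < n ] ∑[ k < n ] (D * (B j k * M j k)) + Q
        ≡⟨ ∑∑-distrib-+ (λ j k → D * (B j k * M j k)) B ⟨
    ∑[ j < n ] ∑[ k < n ] (D * (B j k * M j k) + B j k)
        ≤⟨ ∑-mono-≤ (λ j → ∑-mono-≤ (entry j)) ⟩
    ∑[ j < n ] ∑[ k < n ] (a * L * B j k)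
        ≡⟨ *-distribˡ-∑∑ (a * L) B ⟨
    a * L * Q ∎
    where
    open ≤-Reasoning
    B : Fin n → Fin n → ℕ
    B = block S T
    Q : ℕ
    Q = ∑[ j < n ] ∑[ k < n ] B j k

    empty-entry : ∀ {x} → D * (0 * x) + 0 ≤ a * L * 0
    empty-entry = ≤-reflexive (trans (+-identityʳ _) (trans (*-zeroʳ D) (sym (*-zeroʳ (a * L)))))

    -- a block entry is 0 or 1, and a 1 marks a light entry
    entry : ∀ j k → D * (B j k * M j k) + B j k ≤ a * L * B j k
    entry j k with j ∈? S | k ∈? ∁ T
    ... | yes j∈S | yes k∈∁T = begin
      D * (1 * M j k) + 1   ≡⟨ cong (λ x → D * x + 1) (*-identityˡ (M j k)) ⟩
      D * M j k + 1         ≡⟨ +-comm _ 1 ⟩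
      suc (D * M j k)       ≤⟨ light j∈S (x∈∁p⇒x∉p k∈∁T) ⟩
      a * L                 ≡⟨ *-identityʳ (a * L) ⟨
      a * L * 1             ∎
    ... | yes _ | no _ = empty-entry {M j k}
    ... | no  _ | _    = empty-entry {M j k}

  ∑∑block : (S T : Subset n) → ∑[ j < n ] ∑[ k < n ] block S T j k ≡ ∣ S ∣ * ∣ ∁ T ∣
  ∑∑block {n} S T = begin
    ∑[ j < n ] ∑[ k < n ] block S T j k
      ≡⟨ ∑∑-product (λ j → indicator (j ∈? S)) (λ k → indicator (k ∈? ∁ T)) ⟩
    (∑[ j < n ] indicator (j ∈? S)) * (∑[ k < n ] indicator (k ∈? ∁ T))
      ≡⟨ cong₂ _*_ (∣p∣≡∑𝟙 S) (∣p∣≡∑𝟙 (∁ T)) ⟨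
    ∣ S ∣ * ∣ ∁ T ∣ ∎
    where open ≡-Reasoning

  Heavy : (a D L : ℕ) → (Fin n → Fin n → ℕ) → Fin n → Subset n
  Heavy a D L M j = select (λ k → a * L ≤? D * M j k)

  -- In a balanced matrix the heavy entries satisfy Hall's condition, provided D has
  -- capacity: a set S of rows with fewer heavy columns T would push mass ≥ (∣S∣ − ∣T∣)·L
  -- onto the light block S × ∁ T.
  heavy-hall : ∀ {a D L} {M : Fin n → Fin n → ℕ} → Capacity a n D → Balanced L M →
    HallCondition ⊤ (Heavy a D L M)
  heavy-hall {n} {a} {D} {L} {M} capacity balanced S _ with ∣ Nb (Heavy a D L M) S ∣ <? ∣ S ∣
  ... | no  ∣T∣≮∣S∣ = ≮⇒≥ ∣T∣≮∣S∣
  ... | yes ∣T∣<∣S∣ = ⊥-elim (no-overcrowding {a} capacity ∣T∣<∣S∣ (∣p∣≤n S) ∣T∣+∣∁T∣≡n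
                        (escaping-mass balanced S T)
                        (subst (λ q → D * P + q ≤ a * L * q) (∑∑block S T)
                               (light-block {a = a} {D} {L} {M} S T light)))
    where
    T = Nb (Heavy a D L M) S
    P = ∑[ j < n ] ∑[ k < n ] (block S T j k * M j k)

    light : ∀ {j k} → j ∈ S → k ∉ T → D * M j k < a * L
    light {j} j∈S k∉T =
      ≰⇒> (λ heavy → k∉T (Nb⁺ (Heavy a D L M) S j∈S (select⁺ (λ k → a * L ≤? D * M j k) heavy)))

    ∣T∣+∣∁T∣≡n : ∣ T ∣ + ∣ ∁ T ∣ ≡ n
    ∣T∣+∣∁T∣≡n = trans (cong (∣ T ∣ +_) (∣∁p∣≡n∸∣p∣ T)) (m+[n∸m]≡n (∣p∣≤n T))


-- The arithmetic of α: its denominator has capacity 4 (AM–GM), and the heaviness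
-- threshold 4L / D is exactly 2Lα.
module AlphaArithmetic where

  open import Data.Nat using (ℕ; zero; suc; _+_; _*_; _≤_; _<_; _>_; z≤n; s≤s; ∣_-_∣)
  open import Data.Nat.Properties
    using ( ≤-total; m≤n⇒∃[o]m+o≡n; ∣m-m+n∣≡n; ∣-∣-comm; ∣m-n∣≡0⇒m≡n; +-comm; +-suc
          ; m≤m+n; m<m+n; ≤-pred; *-comm; +-identityʳ)
  open import Data.Nat.Divisibility using (_∣_; _∣?_; divides; ∣m+n∣m⇒∣n; ∣1⇒≡1)
  open import Data.Nat.Tactic.RingSolver using (solve-∀)
  open import Data.Sum using (inj₁; inj₂)
  open import Data.Product using (_,_)
  open import Relation.Nullary using (yes; no; contradiction)
  open import Relation.Binary.PropositionalEquality
  open import Data.Integer using (+_)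
  import Data.Integer as ℤ
  import Data.Integer.Properties as ℤ
  open import Data.Rational using (_/_; toℚᵘ)
  import Data.Rational as ℚ
  import Data.Rational.Properties as ℚ
  open import Data.Rational.Unnormalised using (mkℚᵘ; *≤*)
  import Data.Rational.Unnormalised as ℚᵘ
  import Data.Rational.Unnormalised.Properties as ℚᵘ

  open import Defs using (α)
  open DoubleCounting using (Capacity)

  square-gap-≤ : ∀ {x y} → x ≤ y → 4 * x * y + ∣ x - y ∣ * ∣ x - y ∣ ≡ (x + y) * (x + y)
  square-gap-≤ {x} x≤y with m≤n⇒∃[o]m+o≡n x≤y
  ... | g , refl = trans (cong (λ d → 4 * x * (x + g) + d * d) (∣m-m+n∣≡n x g)) (identity x g)
    where
    identity : ∀ x g → 4 * x * (x + g) + g * g ≡ (x + (x + g)) * (x + (x + g))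
    identity = solve-∀

  square-gap : ∀ x y → 4 * x * y + ∣ x - y ∣ * ∣ x - y ∣ ≡ (x + y) * (x + y)
  square-gap x y with ≤-total x y
  ... | inj₁ x≤y = square-gap-≤ x≤y
  ... | inj₂ y≤x = begin
    4 * x * y + ∣ x - y ∣ * ∣ x - y ∣   ≡⟨ cong₂ (λ p d → p + d * d) (swap x y) (∣-∣-comm x y) ⟩
    4 * y * x + ∣ y - x ∣ * ∣ y - x ∣   ≡⟨ square-gap-≤ y≤x ⟩
    (y + x) * (y + x)                   ≡⟨ cong (λ z → z * z) (+-comm y x) ⟩
    (x + y) * (x + y)                   ∎
    where
    open ≡-Reasoning
    swap : ∀ x y → 4 * x * y ≡ 4 * y * x
    swap = solve-∀

  am-gm : ∀ x y → 4 * x * y ≤ (x + y) * (x + y)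
  am-gm x y = subst (4 * x * y ≤_) (square-gap x y) (m≤m+n _ _)

  am-gm-strict : ∀ x y → x ≢ y → 4 * x * y < (x + y) * (x + y)
  am-gm-strict x y x≢y = subst (4 * x * y <_) (square-gap x y) (m<m+n (4 * x * y) gap²>0)
    where
    gap²>0 : ∣ x - y ∣ * ∣ x - y ∣ > 0
    gap²>0 with ∣ x - y ∣ in gap
    ... | zero  = contradiction (∣m-n∣≡0⇒m≡n gap) x≢y
    ... | suc _ = s≤s z≤n

  odd-sum⇒distinct : ∀ {x y N} → 2 ∣ N → x + y ≡ suc N → x ≢ y
  odd-sum⇒distinct {x} {N = N} 2∣N x+x≡1+N refl with ∣1⇒≡1 (∣m+n∣m⇒∣n 2∣N+1 2∣N)
    where
    2∣N+1 : 2 ∣ N + 1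
    2∣N+1 = divides x (trans (+-comm N 1) (trans (sym x+x≡1+N) (double x)))
      where
      double : ∀ x → x + x ≡ x * 2
      double = solve-∀
  ... | ()

  -- One less than the denominator of α (n + 1): (n+1)(n+3) − 1 if n + 1 is even,
  -- (n+2)² − 1 if n + 1 is odd.
  denominator-pred : ℕ → ℕ
  denominator-pred n with 2 ∣? suc n
  ... | yes _ = suc (suc n) + n * suc (suc (suc n))
  ... | no  _ = suc n + suc n * suc (suc n)

  α-as-fraction : ∀ n → α (suc n) ≡ + 2 / suc (denominator-pred n)
  α-as-fraction n with 2 ∣? suc n
  ... | yes _ = refl
  ... | no  _ = refl

  -- The denominator of α (N) dominates 4s(N + 1 − s) for every s ≤ N (AM–GM; for even N
  -- the two factors have odd sum, hence differ, and the bound improves by one).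
  α-capacity : ∀ n → Capacity 4 (suc n) (suc (denominator-pred n))
  α-capacity n s e s+e≡1+n with 2 ∣? suc n | trans (+-suc s e) (cong suc s+e≡1+n)
  ... | no  _   | sum = subst (λ z → 4 * s * suc e ≤ z * z) sum (am-gm s (suc e))
  ... | yes 2∣N | sum = ≤-pred (subst (4 * s * suc e <_) (trans (cong (λ z → z * z) sum) (square n))
                          (am-gm-strict s (suc e) (odd-sum⇒distinct 2∣N sum)))
    where
    square : ∀ n → suc (suc n) * suc (suc n) ≡ suc (suc n * suc (suc (suc n)))
    square = solve-∀

  toℚᵘ-/ : ∀ a b → toℚᵘ (+ a / suc b) ℚᵘ.≃ mkℚᵘ (+ a) b
  toℚᵘ-/ a b = ℚ.toℚᵘ-fromℚᵘ (mkℚᵘ (+ a) b)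

  threshold : ∀ L c d → 4 * L ≤ suc d * c →
    (+ 2 / 1) ℚ.* (+ L / 1) ℚ.* (+ 2 / suc d) ℚ.≤ + c / 1
  threshold L c d 4L≤Dc =
    ℚ.toℚᵘ-cancel-≤ (ℚᵘ.≤-respˡ-≃ (ℚᵘ.≃-sym product) (ℚᵘ.≤-respʳ-≃ (ℚᵘ.≃-sym (toℚᵘ-/ c 0)) cleared))
    where
    product : toℚᵘ ((+ 2 / 1) ℚ.* (+ L / 1) ℚ.* (+ 2 / suc d))
                ℚᵘ.≃ mkℚᵘ (+ 2) 0 ℚᵘ.* mkℚᵘ (+ L) 0 ℚᵘ.* mkℚᵘ (+ 2) d
    product = ℚᵘ.≃-trans (ℚ.toℚᵘ-homo-* ((+ 2 / 1) ℚ.* (+ L / 1)) (+ 2 / suc d))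
                (ℚᵘ.*-cong (ℚᵘ.≃-trans (ℚ.toℚᵘ-homo-* (+ 2 / 1) (+ L / 1))
                                       (ℚᵘ.*-cong (toℚᵘ-/ 2 0) (toℚᵘ-/ L 0)))
                           (toℚᵘ-/ 2 d))

    cleared : mkℚᵘ (+ 2) 0 ℚᵘ.* mkℚᵘ (+ L) 0 ℚᵘ.* mkℚᵘ (+ 2) d ℚᵘ.≤ mkℚᵘ (+ c) 0
    cleared = *≤* (subst₂ ℤ._≤_ numerators denominators (ℤ.+≤+ 4L≤Dc))
      where
      four : ∀ L → 4 * L ≡ 2 * L * 2 * 1
      four = solve-∀
      numerators : + (4 * L) ≡ + 2 ℤ.* + L ℤ.* + 2 ℤ.* + 1
      numerators = trans (cong +_ (four L)) (trans (ℤ.pos-* (2 * L * 2) 1)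
                     (cong (ℤ._* + 1) (trans (ℤ.pos-* (2 * L) 2) (cong (ℤ._* + 2) (ℤ.pos-* 2 L)))))
      denominators : + (suc d * c) ≡ + c ℤ.* + suc (d + 0)
      denominators = trans (cong +_ (*-comm (suc d) c)) (trans (ℤ.pos-* c (suc d))
                       (cong (λ z → + c ℤ.* + suc z) (sym (+-identityʳ d))))


module Agreement where

  open import Data.Nat using (ℕ)
  open import Data.Fin using (Fin; _≟_)
  open import Data.Fin.Permutation using (Permutation′; _⟨$⟩ʳ_; _⟨$⟩ˡ_; inverseˡ; inverseʳ)
  open import Relation.Binary.PropositionalEquality

  open import Defs using (agreeCount)
  open DoubleCounting using (Balanced)
  open FiniteSums

  private variable n : ℕ

  agreement : ∀ {L} → (Fin L → Permutation′ n) → Fin n → Fin n → ℕ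
  agreement {L = L} σ j k = ∑[ ℓ < L ] indicator (σ ℓ ⟨$⟩ʳ j ≟ k)

  agreeCount≡agreement : ∀ {L} (σ : Fin L → Permutation′ n) (π : Permutation′ n) (j : Fin n) →
    agreeCount σ π j ≡ agreement σ j (π ⟨$⟩ʳ j)
  agreeCount≡agreement σ π j = length-filter-tabulate (λ ℓ → σ ℓ ⟨$⟩ʳ j ≟ π ⟨$⟩ʳ j) (λ ℓ → ℓ)

  -- Each σ_ℓ contributes exactly one 1 to every row and to every column.
  agreement-balanced : ∀ {L} (σ : Fin L → Permutation′ n) → Balanced L (agreement σ)
  agreement-balanced {n} {L} σ = record { row-sum = row-sum ; col-sum = col-sum }
    where
    open ≡-Reasoning
    hit : Fin L → Fin n → Fin n → ℕ
    hit ℓ j k = indicator (σ ℓ ⟨$⟩ʳ j ≟ k)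

    row-sum : ∀ j → ∑[ k < n ] agreement σ j k ≡ L
    row-sum j = begin
      ∑[ k < n ] ∑[ ℓ < L ] hit ℓ j k   ≡⟨ ∑-comm (λ k ℓ → hit ℓ j k) ⟩
      ∑[ ℓ < L ] ∑[ k < n ] hit ℓ j k   ≡⟨ sum-cong-≗ (λ ℓ → ∑-δ (σ ℓ ⟨$⟩ʳ j)) ⟩
      ∑[ ℓ < L ] 1                      ≡⟨ ∑-const-1 ⟩
      L                                 ∎

    col-sum : ∀ k → ∑[ j < n ] agreement σ j k ≡ L
    col-sum k = begin
      ∑[ j < n ] ∑[ ℓ < L ] hit ℓ j k                    ≡⟨ ∑-comm (λ j ℓ → hit ℓ j k) ⟩
      ∑[ ℓ < L ] ∑[ j < n ] hit ℓ j k                    ≡⟨ sum-cong-≗ (λ ℓ → sum-cong-≗ (preimage ℓ)) ⟩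
      ∑[ ℓ < L ] ∑[ j < n ] indicator (σ ℓ ⟨$⟩ˡ k ≟ j)   ≡⟨ sum-cong-≗ (λ ℓ → ∑-δ (σ ℓ ⟨$⟩ˡ k)) ⟩
      ∑[ ℓ < L ] 1                                       ≡⟨ ∑-const-1 ⟩
      L                                                  ∎
      where
      preimage : ∀ ℓ j → hit ℓ j k ≡ indicator (σ ℓ ⟨$⟩ˡ k ≟ j)
      preimage ℓ j = indicator-cong (σ ℓ ⟨$⟩ʳ j ≟ k) (σ ℓ ⟨$⟩ˡ k ≟ j)
        (λ { refl → inverseˡ (σ ℓ) })
        (λ { refl → inverseʳ (σ ℓ) })


open import Defs
open import Data.Nat using (ℕ; _≥_)
open import Data.Fin using (Fin)
open import Data.Fin.Permutation using (Permutation′)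
open import Data.Product using (∃)
open import Data.Integer using (+_)
open import Data.Rational using (_≤_; _*_; _/_)

open import Data.Nat as ℕ using (suc; _≤?_)
open import Data.Fin using (zero)
open import Data.Fin.Permutation using (_⟨$⟩ʳ_)
open import Data.Fin.Subset using (⊤)
open import Data.Fin.Subset.Properties using (∈⊤)
open import Data.Product using (_,_; proj₁; proj₂)
open import Relation.Binary.PropositionalEquality using (_≡_; sym; trans; cong; subst₂)

open FiniteSubsets using (select⁻)
open HallTheorem using (Matching; hall)
open FinitePermutations using (injective⇒permutation)
open DoubleCounting using (Heavy; heavy-hall)
open AlphaArithmetic using (denominator-pred; α-as-fraction; α-capacity; threshold)
open Agreement using (agreement; agreeCount≡agreement; agreement-balanced)

corollary1 : (N L : ℕ) → N ≥ 1 → L ≥ 1 → (σ : Fin L → Permutation′ N) →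
    ∃ λ (π : Permutation′ N) → (j : Fin N) →
      (+ 2 / 1) * (+ L / 1) * α N ≤ (+ agreeCount σ π j / 1)
corollary1 ℕ.zero    _ ()  _ _
corollary1 (suc n) L _ _ σ = π , bound
  where
  D : ℕ
  D = suc (denominator-pred n)

  heavy-matching : Matching ⊤ (Heavy 4 D L (agreement σ))
  heavy-matching = hall zero ⊤ (Heavy 4 D L (agreement σ))
                        (heavy-hall {a = 4} (α-capacity n) (agreement-balanced σ))
  open Matching heavy-matching

  π : Permutation′ (suc n)
  π = proj₁ (injective⇒permutation match (injective ∈⊤ ∈⊤))

  π≗match : ∀ j → π ⟨$⟩ʳ j ≡ match j
  π≗match = proj₂ (injective⇒permutation match (injective ∈⊤ ∈⊤))

  bound : ∀ j → (+ 2 / 1) * (+ L / 1) * α (suc n) ≤ (+ agreeCount σ π j / 1)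
  bound j = subst₂ (λ a c → (+ 2 / 1) * (+ L / 1) * a ≤ + c / 1)
              (sym (α-as-fraction n))
              (sym (trans (agreeCount≡agreement σ π j) (cong (agreement σ j) (π≗match j))))
              (threshold L _ (denominator-pred n)
                (select⁻ (λ k → 4 ℕ.* L ≤? D ℕ.* agreement σ j k) (admissible ∈⊤)))
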